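{- Let $p$ be a prime and $k\ge2$ (with $n\ge k$). Then \[\Phi(n,k,p)\le\mu_p\left(n-k+1-\left\lfloor\frac{n-k+1}{p+1}\right\rfloor\right).\]
   Context: For linear codes over $\mathbb{Z}_p$ (subspaces of $\mathbb{Z}_p^n$), the Lee weight of $a\in\mathbb{Z}_p$ (as an integer in $\{0,\dots,p-1\}$) is $\min\{a,p-a\}$, the Lee weight of a vector is the sum over coordinates, and $d_L(\mathcal{C})$ is the minimum Lee weight of a nonzero codeword. $\Phi(n,k,p)$ is the maximum of $d_L(\mathcal{C})$ over all linear codes $\mathcal{C}\subseteq\mathbb{Z}_p^n$ of dimension $k$. $\mu_p$ is the average Lee weight of the nonzero elements of $\mathbb{Z}_p$: $\mu_2=1$ and $\mu_p=\frac{p+1}{4}$ for odd $p$. -}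

module Defs where

open import Data.Nat using (ℕ; zero; suc; _+_; _*_; _∸_; _⊓_; _/_; _%_; _≡ᵇ_; NonZero)
open import Data.Fin using (Fin; toℕ)
open import Data.Bool using (if_then_else_)

sumFin : ∀ {k} → (Fin k → ℕ) → ℕ
sumFin {zero}  f = 0
sumFin {suc k} f = f Fin.zero + sumFin (λ i → f (Fin.suc i))
  where import Data.Fin as Fin

-- Elements of ℤ_p are represented by Fin p (integers 0..p-1); a vector of
-- ℤ_p^n is a function Fin n → Fin p.  A family of k vectors (rows of a
-- generator matrix) is G : Fin k → Fin n → Fin p.

combo : ∀ {p k n} → .{{NonZero p}} →
        (Fin k → Fin n → Fin p) → (Fin k → Fin p) → Fin n → ℕ
combo {p} G a j = sumFin (λ i → toℕ (a i) * toℕ (G i j)) % p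

LinIndep : ∀ {p k n} → .{{NonZero p}} → (Fin k → Fin n → Fin p) → Set
LinIndep {p} G = ∀ a → (∀ j → combo G a j ≡ 0) → ∀ i → toℕ (a i) ≡ 0
  where open import Relation.Binary.PropositionalEquality using (_≡_)

leeℕ : ℕ → ℕ → ℕ
leeℕ p x = x ⊓ (p ∸ x)

leeWeight : ∀ {n} → ℕ → (Fin n → ℕ) → ℕ
leeWeight p v = sumFin (λ j → leeℕ p (v j))

-- 4·μ_p : μ_2 = 1, μ_p = (p+1)/4 for odd p
fourμ : ℕ → ℕ
fourμ p = if p ≡ᵇ 2 then 4 else suc p

-- Write k = k′ + 2 and n = k′ + (N + 1), so that N = n − k + 1. Solving
-- homogeneous systems by pigeonhole yields coefficient vectors a and b whose
-- codewords vanish on the first k′ coordinates, with a nonzero and b zero at a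
-- common pivot; then a and the s·a + b (s ∈ ℤ_p) are p + 1 nonzero vectors,
-- one on each line through 0 of span {a, b}. At every remaining coordinate one
-- of their p + 1 codewords vanishes, so the Hamming weights of these codewords
-- add up to at most p (N + 1), and one of them has weight w with
-- (p + 1) w ≤ p (N + 1), that is w ≤ N − ⌊N / (p + 1)⌋. Finally, multiplication
-- by a nonzero element permutes ℤ_p, so the p − 1 nonzero multiples of a
-- codeword of Hamming weight w have total Lee weight (p − 1) μ_p w, and one of
-- them has Lee weight at most μ_p w. Linear independence of the rows makes it
-- a nonzero codeword.

{-# OPTIONS --safe #-}
module Submission where

open import Defs
open import Data.Nat
  using (ℕ; zero; suc; _+_; _*_; _∸_; _≤_; _<_; _/_; _%_; NonZero; z≤n; s≤s; s≤s⁻¹; _≤?_; _≟_; nonTrivial⇒n>1)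
open import Data.Nat.Properties
open import Data.Nat.DivMod
open import Data.Nat.Divisibility using (_∣_; divides; m∣m*n; n∣m⇒m%n≡0; m%n≡0⇒n∣m)
open import Data.Nat.Primality using (Prime; euclidsLemma; prime⇒irreducible; prime⇒nonTrivial)
open import Data.Nat.Tactic.RingSolver using (solve)
open import Data.List.Base using (_∷_; [])
open import Data.Fin as Fin using (Fin; zero; suc; toℕ; _↑ˡ_; _↑ʳ_; inject₁; fromℕ; punchIn)
import Data.Fin.Properties as Finₚ
open import Data.Fin.Permutation using (Permutation′; permutation)
open import Data.Product using (∃; ∃₂; _×_; _,_; proj₁; proj₂)
open import Data.Sum using (_⊎_; inj₁; inj₂; [_,_]′)
open import Data.Vec.Functional using (removeAt; insertAt)
open import Data.Vec.Functional.Properties using (insertAt-lookup; insertAt-punchIn)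
open import Data.Empty using (⊥-elim)
open import Function using (_∘_)
open import Function.Definitions using (Injective)
open import Relation.Binary.PropositionalEquality
open import Relation.Nullary using (¬_; yes; no; contradiction)
open import Algebra.Properties.CommutativeMonoid.Sum +-0-commutativeMonoid
  using (sum; sum-syntax; sum-cong-≗; sum-replicate-zero; sum-remove; sum-init-last; ∑-distrib-+; ∑-comm; ∑-permute)
open import Algebra.Properties.Semiring.Sum +-*-semiring using (*-distribˡ-sum)

sumFin≡sum : ∀ {n} (f : Fin n → ℕ) → sumFin f ≡ sum f
sumFin≡sum {zero}  f = refl
sumFin≡sum {suc n} f = cong (f zero +_) (sumFin≡sum (f ∘ suc))

sum-mono-≤ : ∀ {n} {f g : Fin n → ℕ} → (∀ i → f i ≤ g i) → sum f ≤ sum g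
sum-mono-≤ {zero}  f≤g = z≤n
sum-mono-≤ {suc n} f≤g = +-mono-≤ (f≤g zero) (sum-mono-≤ (f≤g ∘ suc))

sum-const : ∀ n c → ∑[ i < n ] c ≡ n * c
sum-const zero    c = refl
sum-const (suc n) c = cong (c +_) (sum-const n c)

sum-zero : ∀ {n} {f : Fin n → ℕ} → (∀ i → f i ≡ 0) → sum f ≡ 0
sum-zero {n} f≡0 = trans (sum-cong-≗ {n} f≡0) (sum-replicate-zero n)

sum-↑ : ∀ m {n} (f : Fin (m + n) → ℕ) →
        sum f ≡ ∑[ i < m ] f (i ↑ˡ n) + ∑[ i < n ] f (m ↑ʳ i)
sum-↑ zero    f = refl
sum-↑ (suc m) f = trans (cong (f zero +_) (sum-↑ m (f ∘ suc))) (sym (+-assoc (f zero) _ _))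

∃-≤-mean : ∀ {n} (f : Fin (suc n) → ℕ) → ∃ λ i → suc n * f i ≤ sum f
∃-≤-mean {zero}  f = zero , ≤-refl
∃-≤-mean {suc n} f with ∃-≤-mean (f ∘ suc)
... | i , mean≤ with f zero ≤? f (suc i)
...   | yes f₀≤ = zero , +-monoʳ-≤ (f zero) (≤-trans (*-monoʳ-≤ (suc n) f₀≤) mean≤)
...   | no  f₀≰ = suc i , +-mono-≤ (<⇒≤ (≰⇒> f₀≰)) mean≤

∃-nonzeroIndex-≤ : ∀ {n} (f : Fin n → ℕ) {B} → 1 < n → sum f ≤ (n ∸ 1) * B →
                   ∃ λ i → toℕ i ≢ 0 × f i ≤ B
∃-nonzeroIndex-≤ {suc zero}    f (s≤s ()) _
∃-nonzeroIndex-≤ {suc (suc n)} f _ ∑f≤ with ∃-≤-mean (f ∘ suc)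
... | i , mean≤ = suc i , (λ ()) , *-cancelˡ-≤ (suc n) (≤-trans mean≤ (m+n≤o⇒n≤o (f zero) ∑f≤))

injective⇒surjective : ∀ {n} {f : Fin n → Fin n} → Injective _≡_ _≡_ f → ∀ y → ∃ λ x → f x ≡ y
injective⇒surjective {zero}  inj ()
injective⇒surjective {suc n} {f} inj y with Finₚ.any? (λ x → f x Finₚ.≟ y)
... | yes hit  = hit
... | no  miss = ⊥-elim (Finₚ.<⇒notInjective (n<1+n n) squeeze-injective)
  where
  y≢f : ∀ x → y ≢ f x
  y≢f x y≡fx = miss (x , sym y≡fx)
  squeeze : Fin (suc n) → Fin n
  squeeze x = Fin.punchOut (y≢f x)
  squeeze-injective : Injective _≡_ _≡_ squeeze
  squeeze-injective eq = inj (Finₚ.punchOut-injective (y≢f _) (y≢f _) eq)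

sum-reindex : ∀ {n} {f : Fin n → Fin n} → Injective _≡_ _≡_ f →
              (g : Fin n → ℕ) → ∑[ i < n ] g (f i) ≡ sum g
sum-reindex {n} {f} inj g = sym (∑-permute g π)
  where
  f⁻¹ : Fin n → Fin n
  f⁻¹ y = proj₁ (injective⇒surjective inj y)
  f∘f⁻¹ : ∀ y → f (f⁻¹ y) ≡ y
  f∘f⁻¹ y = proj₂ (injective⇒surjective inj y)
  π : Permutation′ n
  π = permutation f f⁻¹ f∘f⁻¹ (λ x → inj (f∘f⁻¹ (f x)))

funToFin-cong : ∀ {m n} {f g : Fin m → Fin n} → (∀ i → f i ≡ g i) → Fin.funToFin f ≡ Fin.funToFin g
funToFin-cong {zero}  f≗g = refl
funToFin-cong {suc m} f≗g = cong₂ Fin.combine (f≗g zero) (funToFin-cong (f≗g ∘ suc))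

∃-collision : ∀ {p r c} → 1 < p → c < r → (φ : (Fin r → Fin p) → Fin c → Fin p) →
              ∃₂ λ A B → (∃ λ i → A i ≢ B i) × ∀ j → φ A j ≡ φ B j
∃-collision {p} {r} {c} p>1 c<r φ =
  let x , y , x<y , same = Finₚ.pigeonhole (^-monoʳ-< p p>1 c<r) (Fin.funToFin ∘ φ ∘ Fin.finToFun)
      A = Fin.finToFun {p} {r} x
      B = Fin.finToFun {p} {r} y
      A≢B : ¬ (∀ i → A i ≡ B i)
      A≢B A≗B = Finₚ.<⇒≢ x<y (begin
        x                    ≡⟨ Finₚ.funToFin-finToFin {r} {p} x ⟨
        Fin.funToFin A       ≡⟨ funToFin-cong A≗B ⟩
        Fin.funToFin B       ≡⟨ Finₚ.funToFin-finToFin {r} {p} y ⟩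
        y                    ∎)
  in A , B , Finₚ.¬∀⟶∃¬ r (λ i → A i ≡ B i) (λ i → A i Finₚ.≟ B i) A≢B , λ j → begin
    φ A j                                     ≡⟨ Finₚ.finToFun-funToFin (φ A) j ⟨
    Fin.finToFun (Fin.funToFin (φ A)) j       ≡⟨ cong (λ z → Fin.finToFun z j) same ⟩
    Fin.finToFun (Fin.funToFin (φ B)) j       ≡⟨ Finₚ.finToFun-funToFin (φ B) j ⟩
    φ B j                                     ∎
  where open ≡-Reasoning

nonzero : ℕ → ℕ
nonzero zero    = 0
nonzero (suc _) = 1

hammingWeight : ∀ {n} → (Fin n → ℕ) → ℕ
hammingWeight {n} v = ∑[ j < n ] nonzero (v j)

hammingWeight-≤-pred : ∀ {n} (v : Fin (suc n) → ℕ) {i} → v i ≡ 0 → hammingWeight v ≤ n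
hammingWeight-≤-pred {n} v {i} vᵢ≡0 = begin
  hammingWeight v                       ≡⟨ sum-remove (nonzero ∘ v) ⟩
  nonzero (v i) + hammingWeight v∖i     ≡⟨ cong (λ x → nonzero x + hammingWeight v∖i) vᵢ≡0 ⟩
  hammingWeight v∖i                     ≤⟨ sum-mono-≤ (nonzero≤1 ∘ v∖i) ⟩
  ∑[ j < n ] 1                          ≡⟨ trans (sum-const n 1) (*-identityʳ n) ⟩
  n                                     ∎
  where
  open ≤-Reasoning
  v∖i = removeAt v i
  nonzero≤1 : ∀ x → nonzero x ≤ 1
  nonzero≤1 zero    = z≤n
  nonzero≤1 (suc _) = ≤-refl

sum-hammingWeight-≤ : ∀ {q k m} (c : Fin (suc q) → Fin (k + m) → ℕ) →
                      (∀ d i → c d (i ↑ˡ m) ≡ 0) → (∀ j → ∃ λ d → c d j ≡ 0) →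
                      ∑[ d < suc q ] hammingWeight (c d) ≤ q * m
sum-hammingWeight-≤ {q} {k} {m} c vanish-left ∃-vanish = begin
  ∑[ d < suc q ] hammingWeight (c d)                        ≡⟨ ∑-comm {suc q} {k + m} (λ d j → nonzero (c d j)) ⟩
  ∑[ j < k + m ] column j                                   ≡⟨ sum-↑ k column ⟩
  ∑[ i < k ] column (i ↑ˡ m) + ∑[ i < m ] column (k ↑ʳ i)   ≡⟨ cong (_+ ∑[ i < m ] column (k ↑ʳ i)) left≡0 ⟩
  ∑[ i < m ] column (k ↑ʳ i)                                ≤⟨ sum-mono-≤ right≤q ⟩
  ∑[ i < m ] q                                              ≡⟨ sum-const m q ⟩
  m * q                                                     ≡⟨ *-comm m q ⟩
  q * m                                                     ∎
  where
  open ≤-Reasoning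
  column : Fin (k + m) → ℕ
  column j = hammingWeight (λ d → c d j)
  left≡0 : ∑[ i < k ] column (i ↑ˡ m) ≡ 0
  left≡0 = sum-zero {k} (λ i → sum-zero {suc q} (λ d → cong nonzero (vanish-left d i)))
  right≤q : ∀ i → column (k ↑ʳ i) ≤ q
  right≤q i = hammingWeight-≤-pred (λ d → c d (k ↑ʳ i)) (proj₂ (∃-vanish (k ↑ʳ i)))

[1+d]*w≤d*[1+N]⇒w≤N∸N/[1+d] : ∀ d {w} N → suc d * w ≤ d * suc N → w ≤ N ∸ N / suc d
[1+d]*w≤d*[1+N]⇒w≤N∸N/[1+d] d {w} N dw≤ = m+n≤o⇒m≤o∸n w (s≤s⁻¹ w+q<1+N)
  where
  open ≤-Reasoning
  q = N / suc d
  w+q<1+N : w + q < suc N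
  w+q<1+N = *-cancelˡ-< (suc d) (w + q) (suc N) (begin-strict
    suc d * (w + q)        ≡⟨ *-distribˡ-+ (suc d) w q ⟩
    suc d * w + suc d * q  ≤⟨ +-mono-≤ dw≤ (≤-trans (≤-reflexive (*-comm (suc d) q)) (m/n*n≤m N (suc d))) ⟩
    d * suc N + N          <⟨ +-monoʳ-< (d * suc N) (n<1+n N) ⟩
    d * suc N + suc N      ≡⟨ +-comm (d * suc N) (suc N) ⟩
    suc d * suc N          ∎)

NonZeroVec : ∀ {p k} → (Fin k → Fin p) → Set
NonZeroVec a = ∃ λ i → toℕ (a i) ≢ 0

module Modulo (p : ℕ) .{{_ : NonZero p}} where

  toℕ-mod : ∀ x → toℕ (x mod p) ≡ x % p
  toℕ-mod x = Finₚ.toℕ-fromℕ< (m%n<n x p)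

  toℕ-mod-% : ∀ x → toℕ (x mod p) % p ≡ x % p
  toℕ-mod-% x = trans (cong (_% p) (toℕ-mod x)) (m%n%n≡m%n x p)

  toℕ-0-mod : toℕ (0 mod p) ≡ 0
  toℕ-0-mod = trans (toℕ-mod 0) (m*n%n≡0 0 p)

  <⇒%≢0 : ∀ {x} → x < p → x ≢ 0 → x % p ≢ 0
  <⇒%≢0 x<p x≢0 = x≢0 ∘ trans (sym (m<n⇒m%n≡m x<p))

  +-cong-% : ∀ {x x′ y y′} → x % p ≡ x′ % p → y % p ≡ y′ % p → (x + y) % p ≡ (x′ + y′) % p
  +-cong-% {x} {x′} {y} {y′} x≡x′ y≡y′ = begin
    (x + y) % p             ≡⟨ %-distribˡ-+ x y p ⟩
    (x % p + y % p) % p     ≡⟨ cong₂ (λ u v → (u + v) % p) x≡x′ y≡y′ ⟩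
    (x′ % p + y′ % p) % p   ≡⟨ %-distribˡ-+ x′ y′ p ⟨
    (x′ + y′) % p           ∎
    where open ≡-Reasoning

  *-cong-% : ∀ {x x′ y y′} → x % p ≡ x′ % p → y % p ≡ y′ % p → (x * y) % p ≡ (x′ * y′) % p
  *-cong-% {x} {x′} {y} {y′} x≡x′ y≡y′ = begin
    (x * y) % p             ≡⟨ %-distribˡ-* x y p ⟩
    (x % p * (y % p)) % p   ≡⟨ cong₂ (λ u v → (u * v) % p) x≡x′ y≡y′ ⟩
    (x′ % p * (y′ % p)) % p ≡⟨ %-distribˡ-* x′ y′ p ⟨
    (x′ * y′) % p           ∎
    where open ≡-Reasoning

  sum-cong-% : ∀ {n} {f g : Fin n → ℕ} → (∀ i → f i % p ≡ g i % p) → sum f % p ≡ sum g % p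
  sum-cong-% {zero}  _   = refl
  sum-cong-% {suc n} f≡g = +-cong-% (f≡g zero) (sum-cong-% (f≡g ∘ suc))

  %-≡⇒∣∸ : ∀ x y → x % p ≡ y % p → p ∣ x ∸ y
  %-≡⇒∣∸ x y x≡y = divides (x / p ∸ y / p) (begin
    x ∸ y                                     ≡⟨ cong₂ _∸_ (m≡m%n+[m/n]*n x p) (m≡m%n+[m/n]*n y p) ⟩
    (x % p + x / p * p) ∸ (y % p + y / p * p) ≡⟨ cong (λ r → (x % p + x / p * p) ∸ (r + y / p * p)) x≡y ⟨
    (x % p + x / p * p) ∸ (x % p + y / p * p) ≡⟨ [m+n]∸[m+o]≡n∸o (x % p) _ _ ⟩
    x / p * p ∸ y / p * p                     ≡⟨ *-distribʳ-∸ p (x / p) (y / p) ⟨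
    (x / p ∸ y / p) * p                       ∎)
    where open ≡-Reasoning

  ∸-cancel-% : ∀ {x y} → x < p → y < p → (x + (p ∸ y)) % p ≡ 0 → x ≡ y
  ∸-cancel-% {x} {y} x<p y<p x-y≡0 = begin
    x                       ≡⟨ m<n⇒m%n≡m x<p ⟨
    x % p                   ≡⟨ [m+n]%n≡m%n x p ⟨
    (x + p) % p             ≡⟨ cong (λ z → (x + z) % p) (m∸n+n≡m (<⇒≤ y<p)) ⟨
    (x + (p ∸ y + y)) % p   ≡⟨ cong (_% p) (+-assoc x (p ∸ y) y) ⟨
    (x + (p ∸ y) + y) % p   ≡⟨ +-cong-% (trans x-y≡0 (sym (m*n%n≡0 0 p))) refl ⟩
    y % p                   ≡⟨ m<n⇒m%n≡m y<p ⟩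
    y                       ∎
    where open ≡-Reasoning

  comboℕ : ∀ {k n} → (Fin k → Fin n → Fin p) → (Fin k → ℕ) → Fin n → ℕ
  comboℕ {k} G A j = ∑[ i < k ] (A i * toℕ (G i j))

  module _ {k n} (G : Fin k → Fin n → Fin p) where

    combo≡comboℕ : ∀ (a : Fin k → Fin p) A → (∀ i → toℕ (a i) % p ≡ A i % p) →
                   ∀ j → combo G a j ≡ comboℕ G A j % p
    combo≡comboℕ a A a≡A j = trans (cong (_% p) (sumFin≡sum (λ i → toℕ (a i) * toℕ (G i j))))
                                   (sum-cong-% (λ i → *-cong-% (a≡A i) refl))

    combo-% : ∀ a j → combo G a j % p ≡ comboℕ G (toℕ ∘ a) j % p
    combo-% a j = trans (cong (_% p) (combo≡comboℕ a (toℕ ∘ a) (λ _ → refl) j))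
                        (m%n%n≡m%n (comboℕ G (toℕ ∘ a) j) p)

    combo<p : ∀ a j → combo G a j < p
    combo<p a j = m%n<n (sumFin (λ i → toℕ (a i) * toℕ (G i j))) p

    comboℕ-+ : ∀ A B j → comboℕ G (λ i → A i + B i) j ≡ comboℕ G A j + comboℕ G B j
    comboℕ-+ A B j = trans (sum-cong-≗ (λ i → *-distribʳ-+ (toℕ (G i j)) (A i) (B i)))
                           (∑-distrib-+ (λ i → A i * toℕ (G i j)) (λ i → B i * toℕ (G i j)))

    comboℕ-* : ∀ x A j → comboℕ G (λ i → x * A i) j ≡ x * comboℕ G A j
    comboℕ-* x A j = trans (sum-cong-≗ (λ i → *-assoc x (A i) (toℕ (G i j))))
                           (sym (*-distribˡ-sum x (λ i → A i * toℕ (G i j))))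

    combo-scale : ∀ x a j → combo G (λ i → (x * toℕ (a i)) mod p) j ≡ (x * combo G a j) % p
    combo-scale x a j = begin
      combo G (λ i → (x * toℕ (a i)) mod p) j  ≡⟨ combo≡comboℕ _ (λ i → x * toℕ (a i)) (λ i → toℕ-mod-% _) j ⟩
      comboℕ G (λ i → x * toℕ (a i)) j % p     ≡⟨ cong (_% p) (comboℕ-* x (toℕ ∘ a) j) ⟩
      (x * comboℕ G (toℕ ∘ a) j) % p           ≡⟨ *-cong-% {x} refl (combo-% a j) ⟨
      (x * combo G a j) % p                    ∎
      where open ≡-Reasoning

    combo-affine : ∀ x a b j → combo G (λ i → (x * toℕ (a i) + toℕ (b i)) mod p) j
                                 ≡ (x * combo G a j + combo G b j) % p
    combo-affine x a b j = begin
      combo G (λ i → (x * toℕ (a i) + toℕ (b i)) mod p) j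
        ≡⟨ combo≡comboℕ _ (λ i → x * toℕ (a i) + toℕ (b i)) (λ i → toℕ-mod-% _) j ⟩
      comboℕ G (λ i → x * toℕ (a i) + toℕ (b i)) j % p
        ≡⟨ cong (_% p) (trans (comboℕ-+ (λ i → x * toℕ (a i)) (toℕ ∘ b) j)
                              (cong (_+ comboℕ G (toℕ ∘ b) j) (comboℕ-* x (toℕ ∘ a) j))) ⟩
      (x * comboℕ G (toℕ ∘ a) j + comboℕ G (toℕ ∘ b) j) % p
        ≡⟨ +-cong-% (*-cong-% {x} refl (combo-% a j)) (combo-% b j) ⟨
      (x * combo G a j + combo G b j) % p
        ∎
      where open ≡-Reasoning

    linIndep⇒codeword≢0 : LinIndep G → ∀ {a} → NonZeroVec a → ∃ λ j → combo G a j ≢ 0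
    linIndep⇒codeword≢0 G-indep {a} (i , aᵢ≢0) =
      Finₚ.¬∀⟶∃¬ n (λ j → combo G a j ≡ 0) (λ j → combo G a j ≟ 0) (λ a-kills → aᵢ≢0 (G-indep a a-kills i))

  combo-insertAt-0 : ∀ {k n} (G : Fin (suc k) → Fin n → Fin p) (a : Fin k → Fin p) i j →
                     combo G (insertAt a i (0 mod p)) j ≡ combo (G ∘ punchIn i) a j
  combo-insertAt-0 {k} G a i j = cong (_% p) (begin
    sumFin t                             ≡⟨ sumFin≡sum t ⟩
    sum t                                ≡⟨ sum-remove {i = i} t ⟩
    t i + ∑[ i′ < k ] t (punchIn i i′)   ≡⟨ cong (_+ ∑[ i′ < k ] t (punchIn i i′)) tᵢ≡0 ⟩
    ∑[ i′ < k ] t (punchIn i i′)         ≡⟨ sum-cong-≗ {k} t∘punchIn ⟩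
    sum t′                               ≡⟨ sumFin≡sum t′ ⟨
    sumFin t′                            ∎)
    where
    open ≡-Reasoning
    t : Fin (suc k) → ℕ
    t i′ = toℕ (insertAt a i (0 mod p) i′) * toℕ (G i′ j)
    t′ : Fin k → ℕ
    t′ i′ = toℕ (a i′) * toℕ (G (punchIn i i′) j)
    tᵢ≡0 : t i ≡ 0
    tᵢ≡0 = cong (_* toℕ (G i j)) (trans (cong toℕ (insertAt-lookup a i (0 mod p))) toℕ-0-mod)
    t∘punchIn : ∀ i′ → t (punchIn i i′) ≡ t′ i′
    t∘punchIn i′ = cong (λ z → toℕ z * toℕ (G (punchIn i i′) j)) (insertAt-punchIn a i (0 mod p) i′)

  -- As c < r, two distinct vectors have the same syndrome; their difference solves the system.
  ∃-nonzero-kernel : 1 < p → ∀ {r c} (H : Fin r → Fin c → Fin p) → c < r →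
                     ∃ λ (a : Fin r → Fin p) → NonZeroVec a × ∀ j → combo H a j ≡ 0
  ∃-nonzero-kernel p>1 {r} {c} H c<r =
    let A , B , (i₀ , Aᵢ₀≢Bᵢ₀) , same-syndrome = ∃-collision p>1 c<r syndrome
        -B : Fin r → ℕ
        -B i = p ∸ toℕ (B i)
        d : Fin r → Fin p
        d i = (toℕ (A i) + -B i) mod p
        comboℕ-A≡comboℕ-B : ∀ j → comboℕ H (toℕ ∘ A) j % p ≡ comboℕ H (toℕ ∘ B) j % p
        comboℕ-A≡comboℕ-B j = begin
          comboℕ H (toℕ ∘ A) j % p  ≡⟨ combo-% H A j ⟨
          combo H A j % p           ≡⟨ toℕ-mod (combo H A j) ⟨
          toℕ (syndrome A j)        ≡⟨ cong toℕ (same-syndrome j) ⟩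
          toℕ (syndrome B j)        ≡⟨ toℕ-mod (combo H B j) ⟩
          combo H B j % p           ≡⟨ combo-% H B j ⟩
          comboℕ H (toℕ ∘ B) j % p  ∎
        d≢0 : toℕ (d i₀) ≢ 0
        d≢0 dᵢ₀≡0 = Aᵢ₀≢Bᵢ₀ (Finₚ.toℕ-injective
          (∸-cancel-% (Finₚ.toℕ<n (A i₀)) (Finₚ.toℕ<n (B i₀)) (trans (sym (toℕ-mod _)) dᵢ₀≡0)))
        B+-B≡p : ∀ i → toℕ (B i) + -B i ≡ p
        B+-B≡p i = m+[n∸m]≡n (<⇒≤ (Finₚ.toℕ<n (B i)))
        d-solves : ∀ j → combo H d j ≡ 0
        d-solves j = begin
          combo H d j                                    ≡⟨ combo≡comboℕ H d _ (λ i → toℕ-mod-% _) j ⟩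
          comboℕ H (λ i → toℕ (A i) + -B i) j % p        ≡⟨ cong (_% p) (comboℕ-+ H (toℕ ∘ A) -B j) ⟩
          (comboℕ H (toℕ ∘ A) j + comboℕ H -B j) % p     ≡⟨ +-cong-% (comboℕ-A≡comboℕ-B j) refl ⟩
          (comboℕ H (toℕ ∘ B) j + comboℕ H -B j) % p     ≡⟨ cong (_% p) (comboℕ-+ H (toℕ ∘ B) -B j) ⟨
          comboℕ H (λ i → toℕ (B i) + -B i) j % p        ≡⟨ cong (_% p) (sum-cong-≗ (λ i → cong (_* toℕ (H i j)) (B+-B≡p i))) ⟩
          ∑[ i < r ] (p * toℕ (H i j)) % p               ≡⟨ cong (_% p) (*-distribˡ-sum p (λ i → toℕ (H i j))) ⟨
          (p * ∑[ i < r ] toℕ (H i j)) % p               ≡⟨ n∣m⇒m%n≡0 _ p (m∣m*n _) ⟩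
          0                                              ∎
    in d , (i₀ , d≢0) , d-solves
    where
    open ≡-Reasoning
    syndrome : (Fin r → Fin p) → Fin c → Fin p
    syndrome a j = combo H a j mod p

  record IndependentSolutions {r c} (H : Fin r → Fin c → Fin p) : Set where
    field
      a b       : Fin r → Fin p
      pivot     : Fin r
      a-pivot≢0 : toℕ (a pivot) ≢ 0
      b-pivot≡0 : toℕ (b pivot) ≡ 0
      b≢0       : NonZeroVec b
      a-solves  : ∀ j → combo H a j ≡ 0
      b-solves  : ∀ j → combo H b j ≡ 0

  independentSolutions : 1 < p → ∀ {r c} (H : Fin (suc r) → Fin c → Fin p) → c < r →
                         IndependentSolutions H
  independentSolutions p>1 H c<r =
    let a  , (i  , aᵢ≢0)   , a-solves  = ∃-nonzero-kernel p>1 H (m<n⇒m<1+n c<r)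
        b′ , (i′ , b′ᵢ′≢0) , b′-solves = ∃-nonzero-kernel p>1 (H ∘ punchIn i) c<r
    in record
      { a         = a
      ; b         = insertAt b′ i (0 mod p)
      ; pivot     = i
      ; a-pivot≢0 = aᵢ≢0
      ; b-pivot≡0 = trans (cong toℕ (insertAt-lookup b′ i (0 mod p))) toℕ-0-mod
      ; b≢0       = punchIn i i′ , subst (λ z → toℕ z ≢ 0)
                                         (sym (insertAt-punchIn b′ i (0 mod p) i′)) b′ᵢ′≢0
      ; a-solves  = a-solves
      ; b-solves  = λ j → trans (combo-insertAt-0 H b′ i j) (b′-solves j)
      }

triangle : ∀ t → 2 * ∑[ i < t ] (t ∸ toℕ i) ≡ t * suc t
triangle zero    = refl
triangle (suc t) = begin
  2 * (suc t + ∑[ i < t ] (t ∸ toℕ i))     ≡⟨ *-distribˡ-+ 2 (suc t) _ ⟩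
  2 * suc t + 2 * ∑[ i < t ] (t ∸ toℕ i)   ≡⟨ cong (2 * suc t +_) (triangle t) ⟩
  2 * suc t + t * suc t                    ≡⟨ *-distribʳ-+ (suc t) 2 t ⟨
  suc (suc t) * suc t                      ≡⟨ *-comm (suc (suc t)) (suc t) ⟩
  suc t * suc (suc t)                      ∎
  where open ≡-Reasoning

triangle-reverse : ∀ t → ∑[ i < suc t ] toℕ i ≡ ∑[ i < t ] (t ∸ toℕ i)
triangle-reverse zero    = refl
triangle-reverse (suc t) = begin
  ∑[ i < suc (suc t) ] toℕ i                   ≡⟨ sum-init-last toℕ ⟩
  ∑[ i < suc t ] toℕ (inject₁ i) + toℕ (fromℕ (suc t))
                                               ≡⟨ cong₂ _+_ (sum-cong-≗ {suc t} Finₚ.toℕ-inject₁) (Finₚ.toℕ-fromℕ (suc t)) ⟩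
  ∑[ i < suc t ] toℕ i + suc t                 ≡⟨ cong (_+ suc t) (triangle-reverse t) ⟩
  ∑[ i < t ] (t ∸ toℕ i) + suc t               ≡⟨ +-comm _ (suc t) ⟩
  suc t + ∑[ i < t ] (t ∸ toℕ i)               ∎
  where open ≡-Reasoning

leeℕ-lower-half : ∀ {t y} → y ≤ t → leeℕ (suc t + t) y ≡ y
leeℕ-lower-half {t} {y} y≤t = m≤n⇒m⊓n≡m (begin
  y                 ≤⟨ n≤1+n y ⟩
  suc y             ≤⟨ s≤s y≤t ⟩
  suc t             ≡⟨ m+n∸n≡m (suc t) t ⟨
  suc t + t ∸ t     ≤⟨ ∸-monoʳ-≤ (suc t + t) y≤t ⟩
  suc t + t ∸ y     ∎)
  where open ≤-Reasoning

leeℕ-upper-half : ∀ t i → leeℕ (suc t + t) (suc t + i) ≡ t ∸ i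
leeℕ-upper-half t i rewrite [m+n]∸[m+o]≡n∸o (suc t) t i =
  m≥n⇒m⊓n≡n (≤-trans (m∸n≤m t i) (≤-trans (n≤1+n t) (m≤m+n (suc t) i)))

leeℕ-sum-odd : ∀ t → 4 * ∑[ y < suc t + t ] leeℕ (suc t + t) (toℕ y) ≡ (t + t) * suc (suc (t + t))
leeℕ-sum-odd t = begin
  4 * ∑[ y < suc t + t ] leeℕ p (toℕ y)
    ≡⟨ cong (4 *_) (sum-↑ (suc t) (leeℕ p ∘ toℕ)) ⟩
  4 * (∑[ i < suc t ] leeℕ p (toℕ (i ↑ˡ t)) + ∑[ i < t ] leeℕ p (toℕ (suc t ↑ʳ i)))
    ≡⟨ cong (4 *_) (cong₂ _+_ (sum-cong-≗ {suc t} lower)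
                              (sum-cong-≗ {t} upper)) ⟩
  4 * (∑[ i < suc t ] toℕ i + R)
    ≡⟨ cong (λ L → 4 * (L + R)) (triangle-reverse t) ⟩
  4 * (R + R)
    ≡⟨ cong (λ R′ → 4 * (R + R′)) (+-identityʳ R) ⟨
  4 * (2 * R)
    ≡⟨ cong (4 *_) (triangle t) ⟩
  4 * (t * suc t)
    ≡⟨ solve (t ∷ []) ⟩
  (t + t) * suc (suc (t + t))
    ∎
  where
  open ≡-Reasoning
  p = suc t + t
  R = ∑[ i < t ] (t ∸ toℕ i)
  lower : ∀ i → leeℕ p (toℕ (i ↑ˡ t)) ≡ toℕ i
  lower i = trans (cong (leeℕ p) (Finₚ.toℕ-↑ˡ i t)) (leeℕ-lower-half (Finₚ.toℕ≤pred[n] i))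
  upper : ∀ i → leeℕ p (toℕ (suc t ↑ʳ i)) ≡ t ∸ toℕ i
  upper i = trans (cong (leeℕ p) (Finₚ.toℕ-↑ʳ (suc t) i)) (leeℕ-upper-half t (toℕ i))

even⊎odd : ∀ n → (∃ λ t → n ≡ t + t) ⊎ (∃ λ t → n ≡ suc t + t)
even⊎odd zero    = inj₁ (0 , refl)
even⊎odd (suc n) with even⊎odd n
... | inj₁ (t , refl) = inj₂ (t , refl)
... | inj₂ (t , refl) = inj₁ (suc t , cong suc (sym (+-suc t t)))

prime⇒≡2⊎odd : ∀ {p} → Prime p → p ≡ 2 ⊎ ∃ λ t → p ≡ suc t + t
prime⇒≡2⊎odd {p} p-prime with even⊎odd p
... | inj₁ (t , refl) = inj₁ ([ (λ ()) , sym ]′ (prime⇒irreducible p-prime 2∣t+t))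
  where
  2∣t+t : 2 ∣ t + t
  2∣t+t = divides t (trans (cong (t +_) (sym (+-identityʳ t))) (*-comm 2 t))
... | inj₂ odd        = inj₂ odd

fourμ-odd : ∀ t → fourμ (suc t + t) ≡ suc (suc (t + t))
fourμ-odd zero    = refl
fourμ-odd (suc t) rewrite +-suc t t = refl

leeℕ-sum : ∀ {p} → Prime p → 4 * ∑[ y < p ] leeℕ p (toℕ y) ≡ (p ∸ 1) * fourμ p
leeℕ-sum p-prime with prime⇒≡2⊎odd p-prime
... | inj₁ refl       = refl
... | inj₂ (t , refl) = trans (leeℕ-sum-odd t) (cong ((t + t) *_) (sym (fourμ-odd t)))

leeWeight-cong : ∀ {n} p {v w : Fin n → ℕ} → (∀ j → v j ≡ w j) → leeWeight p v ≡ leeWeight p w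
leeWeight-cong {zero}  p v≗w = refl
leeWeight-cong {suc n} p v≗w = cong₂ _+_ (cong (leeℕ p) (v≗w zero)) (leeWeight-cong p (v≗w ∘ suc))

module PrimeField (p : ℕ) .{{_ : NonZero p}} (p-prime : Prime p) where
  open Modulo p

  p>1 : 1 < p
  p>1 = nonTrivial⇒n>1 p {{prime⇒nonTrivial p-prime}}

  *-≢0-% : ∀ {x y} → x % p ≢ 0 → y % p ≢ 0 → (x * y) % p ≢ 0
  *-≢0-% {x} {y} x≢0 y≢0 xy≡0 with euclidsLemma x y p-prime (m%n≡0⇒n∣m (x * y) p xy≡0)
  ... | inj₁ p∣x = x≢0 (n∣m⇒m%n≡0 x p p∣x)
  ... | inj₂ p∣y = y≢0 (n∣m⇒m%n≡0 y p p∣y)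

  *-cancelʳ-≤-% : ∀ {a b x} → x % p ≢ 0 → a < p → (a * x) % p ≡ (b * x) % p → a ≤ b
  *-cancelʳ-≤-% {a} {b} {x} x≢0 a<p ax≡bx = m∸n≡0⇒m≤n (begin
    a ∸ b       ≡⟨ m<n⇒m%n≡m (≤-<-trans (m∸n≤m a b) a<p) ⟨
    (a ∸ b) % p ≡⟨ n∣m⇒m%n≡0 _ p p∣a∸b ⟩
    0           ∎)
    where
    open ≡-Reasoning
    p∣a∸b : p ∣ a ∸ b
    p∣a∸b with euclidsLemma (a ∸ b) x p-prime
                 (subst (p ∣_) (sym (*-distribʳ-∸ x a b)) (%-≡⇒∣∸ _ _ ax≡bx))
    ... | inj₁ p∣a∸b = p∣a∸b
    ... | inj₂ p∣x   = contradiction (n∣m⇒m%n≡0 x p p∣x) x≢0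

  scale : ℕ → Fin p → Fin p
  scale x l = (toℕ l * x) mod p

  scale-injective : ∀ {x} → x % p ≢ 0 → Injective _≡_ _≡_ (scale x)
  scale-injective x≢0 {l} {l′} eq = Finₚ.toℕ-injective (≤-antisym
    (*-cancelʳ-≤-% x≢0 (Finₚ.toℕ<n l) lx≡l′x) (*-cancelʳ-≤-% x≢0 (Finₚ.toℕ<n l′) (sym lx≡l′x)))
    where
    lx≡l′x = trans (sym (toℕ-mod _)) (trans (cong toℕ eq) (toℕ-mod _))

  ∃-root : ∀ {u} → u % p ≢ 0 → ∀ v → ∃ λ (s : Fin p) → (toℕ s * u + v) % p ≡ 0
  ∃-root {u} u≢0 v =
    let s , su≡-v = injective⇒surjective (scale-injective u≢0) ((p ∸ v % p) mod p)
    in s , (begin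
      (toℕ s * u + v) % p       ≡⟨ +-cong-% (trans (sym (toℕ-mod _)) (trans (cong toℕ su≡-v) (toℕ-mod _)))
                                            (sym (m%n%n≡m%n v p)) ⟩
      (p ∸ v % p + v % p) % p   ≡⟨ cong (_% p) (m∸n+n≡m (m%n≤n v p)) ⟩
      p % p                     ≡⟨ n%n≡0 p ⟩
      0                         ∎)
    where open ≡-Reasoning

  scale-nonzero : ∀ {k x} {a : Fin k → Fin p} → x % p ≢ 0 → NonZeroVec a →
                  NonZeroVec (λ i → (x * toℕ (a i)) mod p)
  scale-nonzero x≢0 (i , aᵢ≢0) = i , λ xaᵢ≡0 →
    *-≢0-% x≢0 (<⇒%≢0 (Finₚ.toℕ<n _) aᵢ≢0) (trans (sym (toℕ-mod _)) xaᵢ≡0)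

  leeℕ-sum-multiples : ∀ x → x < p →
                      ∑[ l < p ] (4 * leeℕ p ((toℕ l * x) % p)) ≡ (p ∸ 1) * fourμ p * nonzero x
  leeℕ-sum-multiples zero _ =
    trans (sum-zero {p} term≡0) (sym (*-zeroʳ ((p ∸ 1) * fourμ p)))
    where
    term≡0 : ∀ l → 4 * leeℕ p ((toℕ l * 0) % p) ≡ 0
    term≡0 l = cong (λ z → 4 * leeℕ p z) (trans (cong (_% p) (*-zeroʳ (toℕ l))) (m*n%n≡0 0 p))
  leeℕ-sum-multiples x@(suc _) x<p = begin
    ∑[ l < p ] (4 * leeℕ p ((toℕ l * x) % p))   ≡⟨ sum-cong-≗ {p} (λ l → cong (λ z → 4 * leeℕ p z) (toℕ-mod _)) ⟨
    ∑[ l < p ] (4 * leeℕ p (toℕ (scale x l)))   ≡⟨ sum-reindex (scale-injective x≢0) (λ y → 4 * leeℕ p (toℕ y)) ⟩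
    ∑[ y < p ] (4 * leeℕ p (toℕ y))             ≡⟨ *-distribˡ-sum {p} 4 (λ y → leeℕ p (toℕ y)) ⟨
    4 * ∑[ y < p ] leeℕ p (toℕ y)               ≡⟨ leeℕ-sum p-prime ⟩
    (p ∸ 1) * fourμ p                           ≡⟨ *-identityʳ _ ⟨
    (p ∸ 1) * fourμ p * 1                       ∎
    where
    open ≡-Reasoning
    x≢0 : x % p ≢ 0
    x≢0 = <⇒%≢0 x<p (λ ())

  leeWeight-sum-multiples : ∀ {n} (v : Fin n → ℕ) → (∀ j → v j < p) →
                     ∑[ l < p ] (4 * leeWeight p (λ j → (toℕ l * v j) % p))
                       ≡ (p ∸ 1) * fourμ p * hammingWeight v
  leeWeight-sum-multiples {n} v v<p = begin
    ∑[ l < p ] (4 * leeWeight p (λ j → (toℕ l * v j) % p))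
      ≡⟨ sum-cong-≗ {p} (λ l → trans (cong (4 *_) (sumFin≡sum (lee l))) (*-distribˡ-sum 4 (lee l))) ⟩
    ∑[ l < p ] ∑[ j < n ] (4 * leeℕ p ((toℕ l * v j) % p))
      ≡⟨ ∑-comm {p} {n} (λ l j → 4 * leeℕ p ((toℕ l * v j) % p)) ⟩
    ∑[ j < n ] ∑[ l < p ] (4 * leeℕ p ((toℕ l * v j) % p))
      ≡⟨ sum-cong-≗ {n} (λ j → leeℕ-sum-multiples (v j) (v<p j)) ⟩
    ∑[ j < n ] ((p ∸ 1) * fourμ p * nonzero (v j))
      ≡⟨ *-distribˡ-sum {n} ((p ∸ 1) * fourμ p) (nonzero ∘ v) ⟨
    (p ∸ 1) * fourμ p * hammingWeight v
      ∎
    where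
    open ≡-Reasoning
    lee : Fin p → Fin n → ℕ
    lee l j = leeℕ p ((toℕ l * v j) % p)

  ∃-multiple-lee-≤ : ∀ {k n} (G : Fin k → Fin n → Fin p) {a} → NonZeroVec a →
                     ∃ λ a′ → NonZeroVec a′ ×
                       4 * leeWeight p (combo G a′) ≤ fourμ p * hammingWeight (combo G a)
  ∃-multiple-lee-≤ G {a} a≢0 =
    let l , l≢0 , lee≤ = ∃-nonzeroIndex-≤ _ p>1 (≤-reflexive (trans
                           (leeWeight-sum-multiples (combo G a) (combo<p G a)) (*-assoc (p ∸ 1) (fourμ p) _)))
    in (λ i → (toℕ l * toℕ (a i)) mod p) , scale-nonzero (<⇒%≢0 (Finₚ.toℕ<n l) l≢0) a≢0 ,
       ≤-trans (≤-reflexive (cong (4 *_) (leeWeight-cong p (combo-scale G (toℕ l) a)))) lee≤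

  module Pencil {k n} (G : Fin k → Fin n → Fin p) (a b : Fin k → Fin p) where

    -- One nonzero vector on each of the p + 1 lines through 0 in span {a, b}.
    point : Fin (suc p) → Fin k → Fin p
    point zero    = a
    point (suc s) = λ i → (toℕ s * toℕ (a i) + toℕ (b i)) mod p

    point-vanishes : ∀ {j} → combo G a j ≡ 0 → combo G b j ≡ 0 → ∀ d → combo G (point d) j ≡ 0
    point-vanishes     aⱼ≡0 bⱼ≡0 zero    = aⱼ≡0
    point-vanishes {j} aⱼ≡0 bⱼ≡0 (suc s) = begin
      combo G (point (suc s)) j                ≡⟨ combo-affine G (toℕ s) a b j ⟩
      (toℕ s * combo G a j + combo G b j) % p  ≡⟨ cong₂ (λ u v → (toℕ s * u + v) % p) aⱼ≡0 bⱼ≡0 ⟩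
      (toℕ s * 0 + 0) % p                      ≡⟨ cong (λ z → (z + 0) % p) (*-zeroʳ (toℕ s)) ⟩
      0 % p                                    ≡⟨ m*n%n≡0 0 p ⟩
      0                                        ∎
      where open ≡-Reasoning

    ∃-point-vanishing : ∀ j → ∃ λ d → combo G (point d) j ≡ 0
    ∃-point-vanishing j with combo G a j ≟ 0
    ... | yes aⱼ≡0 = zero , aⱼ≡0
    ... | no  aⱼ≢0 =
      let s , root = ∃-root (<⇒%≢0 (combo<p G a j) aⱼ≢0) (combo G b j)
      in suc s , trans (combo-affine G (toℕ s) a b j) root

    point-nonzero : ∀ {i} → toℕ (a i) ≢ 0 → toℕ (b i) ≡ 0 → NonZeroVec b → ∀ d → NonZeroVec (point d)
    point-nonzero aᵢ≢0 _ _ zero = _ , aᵢ≢0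
    point-nonzero {i} aᵢ≢0 bᵢ≡0 (i′ , bᵢ′≢0) (suc s) with toℕ s ≟ 0
    ... | yes s≡0 = i′ , λ eq → bᵢ′≢0 (begin
      toℕ (b i′)                                ≡⟨ m<n⇒m%n≡m (Finₚ.toℕ<n (b i′)) ⟨
      toℕ (b i′) % p                            ≡⟨ cong (λ z → (z * toℕ (a i′) + toℕ (b i′)) % p) s≡0 ⟨
      (toℕ s * toℕ (a i′) + toℕ (b i′)) % p     ≡⟨ toℕ-mod _ ⟨
      toℕ (point (suc s) i′)                    ≡⟨ eq ⟩
      0                                         ∎)
      where open ≡-Reasoning
    ... | no  s≢0 = i , λ eq → *-≢0-% (<⇒%≢0 (Finₚ.toℕ<n s) s≢0)
                                      (<⇒%≢0 (Finₚ.toℕ<n (a i)) aᵢ≢0) (begin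
      (toℕ s * toℕ (a i)) % p                   ≡⟨ cong (_% p) (+-identityʳ _) ⟨
      (toℕ s * toℕ (a i) + 0) % p               ≡⟨ cong (λ z → (toℕ s * toℕ (a i) + z) % p) bᵢ≡0 ⟨
      (toℕ s * toℕ (a i) + toℕ (b i)) % p       ≡⟨ toℕ-mod _ ⟨
      toℕ (point (suc s) i)                     ≡⟨ eq ⟩
      0                                         ∎)
      where open ≡-Reasoning

  ∃-codeword-weight-≤ : ∀ {k′ N} (G : Fin (2 + k′) → Fin (k′ + suc N) → Fin p) →
                        ∃ λ a → NonZeroVec a × hammingWeight (combo G a) ≤ N ∸ N / suc p
  ∃-codeword-weight-≤ {k′} {N} G =
    let d , mean≤ = ∃-≤-mean (hammingWeight ∘ codeword)
    in point d , point-nonzero a-pivot≢0 b-pivot≡0 b≢0 d ,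
       [1+d]*w≤d*[1+N]⇒w≤N∸N/[1+d] p N (≤-trans mean≤ ∑weight≤)
    where
    open IndependentSolutions (independentSolutions p>1 (λ i s → G i (s ↑ˡ suc N)) (n<1+n k′))
    open Pencil G a b
    codeword : Fin (suc p) → Fin (k′ + suc N) → ℕ
    codeword d = combo G (point d)
    ∑weight≤ : ∑[ d < suc p ] hammingWeight (codeword d) ≤ p * suc N
    ∑weight≤ = sum-hammingWeight-≤ codeword (λ d s → point-vanishes (a-solves s) (b-solves s) d)
                                   ∃-point-vanishing

split-length : ∀ k′ {n} → 2 + k′ ≤ n → ∃ λ N → k′ + suc N ≡ n × n ∸ (2 + k′) + 1 ≡ N
split-length k′ {n} k≤n = n ∸ (2 + k′) + 1 , trans (regroup k′ (n ∸ (2 + k′))) (m+[n∸m]≡n k≤n) , refl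
  where
  regroup : ∀ x y → x + suc (y + 1) ≡ 2 + x + y
  regroup x y = solve (x ∷ y ∷ [])

corollary16 : (p k n : ℕ) → .{{_ : NonZero p}} → Prime p → 2 ≤ k → k ≤ n →
    (G : Fin k → Fin n → Fin p) → LinIndep G →
    ∃ λ (a : Fin k → Fin p) → (∃ λ j → combo G a j ≢ 0) ×
      4 * leeWeight p (combo G a)
        ≤ fourμ p * ((n ∸ k + 1) ∸ ((n ∸ k + 1) / suc p))
corollary16 p (suc (suc k′)) n p-prime (s≤s (s≤s z≤n)) k≤n G G-indep with split-length k′ k≤n
... | N , refl , n∸k+1≡N rewrite n∸k+1≡N =
  let a  , a≢0  , weight≤ = ∃-codeword-weight-≤ G
      a′ , a′≢0 , lee≤    = ∃-multiple-lee-≤ G a≢0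
  in a′ , linIndep⇒codeword≢0 G G-indep a′≢0 , ≤-trans lee≤ (*-monoʳ-≤ (fourμ p) weight≤)
  where
  open Modulo p
  open PrimeField p p-prime
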